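{- Let $\Gamma=(H,\sigma)$ be a signed hypergraph with $H=(V,E)$ and normalized Laplacian $L$. Then for any two functions $f,g:V\to\mathbb{R}$, $$\langle fg, L(fg)\rangle=\langle fg, fLg\rangle+\sum_{\{x,y\}}\deg(x)\,(-L_{xy})\,g(x)g(y)\,(f(x)-f(y))^2,$$ where $fg$ denotes the pointwise product and the sum runs over unordered pairs $\{x,y\}$ of distinct vertices lying in a common edge of $E$.
   Context: A signed hypergraph $\Gamma=(H,\sigma)$: finite hypergraph $H=(V,E)$ with signs $\sigma(v,e)\in\{\pm1\}$ on incidences $v\in e$; $\mathrm{sgn}(e)=(-1)^{|e|-1}\prod_{v\in e}\sigma(v,e)$. $\deg(i)$ is the number of edges containing $i$ (assumed positive for all $i$). $A_{ij}=\sum_{e\in E:\,i,j\in e}\mathrm{sgn}(e)$ for $i\neq j$, $A_{ii}=0$, and $L=I-D^{ -1}A$ with $D=\mathrm{diag}(\deg)$; $L_{xy}$ denote its entries (so $\deg(x)(-L_{xy})=A_{xy}$ for $x\ne y$). The inner product is $\langle f,g\rangle=\sum_{i\in V}\deg(i)f(i)g(i)$.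
   Formalization: The functions f and g take values in ℚ instead of ℝ. -}

module Defs where

open import Data.Nat as ℕ using (ℕ; zero; suc)
open import Data.Integer using (ℤ; +_)
open import Data.Fin using (Fin; zero; suc; toℕ)
open import Data.Fin.Subset using (Subset; _∈_; ∣_∣)
open import Data.Fin.Subset.Properties using (_∈?_)
open import Data.Bool using (Bool; true; false; _∧_; _∨_; if_then_else_)
open import Data.Sign using (Sign)
open import Data.Rational using (ℚ; 0ℚ; 1ℚ; _+_; _*_; _-_; -_; _/_)
open import Relation.Nullary using (does)
open import Relation.Binary.PropositionalEquality using (_≡_)

record SignedHypergraph (n m : ℕ) : Set where
  field
    edge : Fin m → Subset n
    σ    : Fin m → Fin n → Sign   -- σ(v,e); only its values for v ∈ e matter

open SignedHypergraph public

Σℚ : ∀ {k} → (Fin k → ℚ) → ℚ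
Σℚ {zero}  f = 0ℚ
Σℚ {suc k} f = f zero + Σℚ (λ i → f (suc i))

Πℚ : ∀ {k} → (Fin k → ℚ) → ℚ
Πℚ {zero}  f = 1ℚ
Πℚ {suc k} f = f zero * Πℚ (λ i → f (suc i))

anyB : ∀ {k} → (Fin k → Bool) → Bool
anyB {zero}  p = false
anyB {suc k} p = p zero ∨ anyB (λ i → p (suc i))

ℕtoℚ : ℕ → ℚ
ℕtoℚ k = (+ k) / 1

signℚ : Sign → ℚ
signℚ Sign.+ = 1ℚ
signℚ Sign.- = - 1ℚ

_^ℚ_ : ℚ → ℕ → ℚ
q ^ℚ zero  = 1ℚ
q ^ℚ suc k = q * (q ^ℚ k)

inB : ∀ {n} → Fin n → Subset n → Bool
inB x p = does (x ∈? p)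

module _ {n m : ℕ} (Γ : SignedHypergraph n m) where

  deg : Fin n → ℕ
  deg i = go (λ e → inB i (edge Γ e))
    where
      go : ∀ {k} → (Fin k → Bool) → ℕ
      go {zero}  p = 0
      go {suc k} p = (if p zero then 1 else 0) ℕ.+ go (λ j → p (suc j))

  sgn : Fin m → ℚ
  sgn e = ((- 1ℚ) ^ℚ (∣ edge Γ e ∣ ℕ.∸ 1))
          * Πℚ (λ v → if inB v (edge Γ e) then signℚ (σ Γ e v) else 1ℚ)

  A : Fin n → Fin n → ℚ
  A i j = if does (i Data.Fin.≟ j) then 0ℚ
          else Σℚ (λ e → if inB i (edge Γ e) ∧ inB j (edge Γ e) then sgn e else 0ℚ)

  -- 1 / deg(i); (deg assumed positive, the value at 0 is irrelevant)
  invℕ : ℕ → ℚ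
  invℕ zero    = 0ℚ
  invℕ (suc k) = (+ 1) / (suc k)

  L : Fin n → Fin n → ℚ
  L x y = (if does (x Data.Fin.≟ y) then 1ℚ else 0ℚ) - invℕ (deg x) * A x y

  applyL : (Fin n → ℚ) → Fin n → ℚ
  applyL f x = Σℚ (λ y → L x y * f y)

  ⟪_,_⟫ : (Fin n → ℚ) → (Fin n → ℚ) → ℚ
  ⟪ f , g ⟫ = Σℚ (λ i → ℕtoℚ (deg i) * f i * g i)

  commonEdge : Fin n → Fin n → Bool
  commonEdge x y = anyB (λ e → inB x (edge Γ e) ∧ inB y (edge Γ e))

  -- sum over unordered pairs {x,y} of distinct vertices lying in a common edge
  -- (each unordered pair is enumerated once, as x < y)
  ΣPairs : (Fin n → Fin n → ℚ) → ℚ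
  ΣPairs t = Σℚ (λ x → Σℚ (λ y →
               if does (toℕ x ℕ.<? toℕ y) ∧ commonEdge x y then t x y else 0ℚ))

_·_ : ∀ {n} → (Fin n → ℚ) → (Fin n → ℚ) → Fin n → ℚ
(f · g) i = f i * g i

{-# OPTIONS --safe #-}
-- By the discrete Leibniz rule, deg x · L(fg)(x) = deg x · f(x) · (Lg)(x) + Σ_y g(y) · deg x · L_xy · (f(y) − f(x)),
-- and deg x · L_xy = −A_xy off the diagonal, so ⟨fg, L(fg)⟩ − ⟨fg, f Lg⟩ = Σ_{x,y} A_xy g(x) g(y) f(x) (f(x) − f(y)).
-- Adding the (x,y) and (y,x) terms, A being symmetric, gives Σ_{x<y} A_xy g(x) g(y) (f(x) − f(y))²;
-- finally A_xy = deg x · (−L_xy), and A_xy = 0 unless x and y share an edge.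
module Submission where

open import Defs
open import Data.Nat using (ℕ; _<_)
open import Data.Fin using (Fin)
open import Data.Rational using (ℚ; _+_; _*_; _-_; -_)
open import Relation.Binary.PropositionalEquality using (_≡_)

open import Algebra.Bundles using (CommutativeRing)
open import Data.Bool using (Bool; true; false; _∧_; if_then_else_)
open import Data.Bool.Properties using (∧-comm)
open import Data.Fin as Fin using (zero; suc; _≟_; _<?_)
open import Data.Fin.Properties using (<-cmp; <-irrefl; <⇒≢)
import Data.Integer as ℤ
open import Data.Nat using (suc)
import Data.Nat.Coprimality as Coprime
open import Data.Rational using (0ℚ; 1ℚ; mkℚ)
open import Data.Rational.Properties
  using (+-*-commutativeRing; normalize-coprime; *-inverseʳ; +-identityˡ; +-identityʳ; *-identityˡ; *-assoc)
open import Data.Rational.Solver using (module +-*-Solver)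
open import Function using (_∘_; flip)
open import Relation.Binary.Definitions using (tri<; tri≈; tri>)
open import Relation.Binary.PropositionalEquality using (_≢_; _≗_; refl; sym; trans; cong; cong₂; module ≡-Reasoning)
open import Relation.Nullary using (Dec; yes; no; does)
open import Relation.Nullary.Decidable using (dec-true; dec-false)

open import Algebra.Properties.Semiring.Sum (CommutativeRing.semiring +-*-commutativeRing)
  using (sum; sum-cong-≗; ∑-distrib-+; ∑-comm; *-distribˡ-sum)

open +-*-Solver
open ≡-Reasoning

Σℚ≡sum : ∀ {k} (f : Fin k → ℚ) → Σℚ f ≡ sum f
Σℚ≡sum {0}     f = refl
Σℚ≡sum {suc k} f = cong (f zero +_) (Σℚ≡sum (f ∘ suc))

Σℚ-cong : ∀ {k} {f g : Fin k → ℚ} → f ≗ g → Σℚ f ≡ Σℚ g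
Σℚ-cong {f = f} {g} f≗g = begin
  Σℚ f   ≡⟨ Σℚ≡sum f ⟩
  sum f  ≡⟨ sum-cong-≗ f≗g ⟩
  sum g  ≡⟨ Σℚ≡sum g ⟨
  Σℚ g   ∎

Σℚ-distrib-+ : ∀ {k} (f g : Fin k → ℚ) → Σℚ (λ i → f i + g i) ≡ Σℚ f + Σℚ g
Σℚ-distrib-+ f g = begin
  Σℚ (λ i → f i + g i)  ≡⟨ Σℚ≡sum (λ i → f i + g i) ⟩
  sum (λ i → f i + g i) ≡⟨ ∑-distrib-+ f g ⟩
  sum f + sum g         ≡⟨ cong₂ _+_ (Σℚ≡sum f) (Σℚ≡sum g) ⟨
  Σℚ f + Σℚ g           ∎

*-distribˡ-Σℚ : ∀ {k} c (f : Fin k → ℚ) → c * Σℚ f ≡ Σℚ (λ i → c * f i)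
*-distribˡ-Σℚ c f = begin
  c * Σℚ f               ≡⟨ cong (c *_) (Σℚ≡sum f) ⟩
  c * sum f              ≡⟨ *-distribˡ-sum c f ⟩
  sum (λ i → c * f i)    ≡⟨ Σℚ≡sum (λ i → c * f i) ⟨
  Σℚ (λ i → c * f i)     ∎

Σℚ²≡sum² : ∀ {k l} (h : Fin k → Fin l → ℚ) → Σℚ (λ x → Σℚ (h x)) ≡ sum (λ x → sum (h x))
Σℚ²≡sum² h = trans (Σℚ≡sum (λ x → Σℚ (h x))) (sum-cong-≗ (Σℚ≡sum ∘ h))

Σℚ-comm : ∀ {k l} (h : Fin k → Fin l → ℚ) →
          Σℚ (λ x → Σℚ (h x)) ≡ Σℚ (λ y → Σℚ (λ x → h x y))
Σℚ-comm h = trans (Σℚ²≡sum² h) (trans (∑-comm h) (sym (Σℚ²≡sum² (flip h))))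

Σℚ-if-anyB-false : ∀ {k} (p : Fin k → Bool) (h : Fin k → ℚ) → anyB p ≡ false →
                   Σℚ (λ i → if p i then h i else 0ℚ) ≡ 0ℚ
Σℚ-if-anyB-false {0}     p h none = refl
Σℚ-if-anyB-false {suc k} p h none with p zero
... | false = trans (+-identityˡ _) (Σℚ-if-anyB-false (p ∘ suc) (h ∘ suc) none)

if-distrib-+ : ∀ b (u v : ℚ) →
               (if b then u else 0ℚ) + (if b then v else 0ℚ) ≡ (if b then u + v else 0ℚ)
if-distrib-+ true  u v = refl
if-distrib-+ false u v = +-identityˡ 0ℚ

split-by-order : ∀ {k} (h : Fin k → Fin k → ℚ) → (∀ x → h x x ≡ 0ℚ) → ∀ x y →
                 h x y ≡ (if does (x <? y) then h x y else 0ℚ) + (if does (y <? x) then h x y else 0ℚ)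
split-by-order h diag x y with <-cmp x y
... | tri< x<y _ y≮x rewrite dec-true (x <? y) x<y | dec-false (y <? x) y≮x = sym (+-identityʳ _)
... | tri> x≮y _ y<x rewrite dec-false (x <? y) x≮y | dec-true (y <? x) y<x = sym (+-identityˡ _)
... | tri≈ _ refl _  rewrite dec-false (x <? x) (<-irrefl refl) = trans (diag x) (sym (+-identityˡ 0ℚ))

Σℚ²-symmetrise : ∀ {k} (h : Fin k → Fin k → ℚ) → (∀ x → h x x ≡ 0ℚ) →
                 Σℚ (λ x → Σℚ (h x)) ≡ Σℚ (λ x → Σℚ (λ y → if does (x <? y) then h x y + h y x else 0ℚ))
Σℚ²-symmetrise h diag = begin
  Σℚ (λ x → Σℚ (h x))
    ≡⟨ Σℚ-cong (λ x → Σℚ-cong (split-by-order h diag x)) ⟩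
  Σℚ (λ x → Σℚ (λ y → below x y + above x y))
    ≡⟨ Σℚ-cong (λ x → Σℚ-distrib-+ (below x) (above x)) ⟩
  Σℚ (λ x → Σℚ (below x) + Σℚ (above x))
    ≡⟨ Σℚ-distrib-+ (λ x → Σℚ (below x)) (λ x → Σℚ (above x)) ⟩
  Σℚ (λ x → Σℚ (below x)) + Σℚ (λ x → Σℚ (above x))
    ≡⟨ cong (Σℚ (λ x → Σℚ (below x)) +_) (Σℚ-comm above) ⟩
  Σℚ (λ x → Σℚ (below x)) + Σℚ (λ y → Σℚ (λ x → above x y))
    ≡⟨ Σℚ-distrib-+ (λ x → Σℚ (below x)) (λ y → Σℚ (λ x → above x y)) ⟨
  Σℚ (λ x → Σℚ (below x) + Σℚ (λ y → above y x))
    ≡⟨ Σℚ-cong (λ x → Σℚ-distrib-+ (below x) (λ y → above y x)) ⟨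
  Σℚ (λ x → Σℚ (λ y → below x y + above y x))
    ≡⟨ Σℚ-cong (λ x → Σℚ-cong (λ y → if-distrib-+ (does (x <? y)) (h x y) (h y x))) ⟩
  Σℚ (λ x → Σℚ (λ y → if does (x <? y) then h x y + h y x else 0ℚ)) ∎
  where
  below above : _ → _ → ℚ
  below x y = if does (x <? y) then h x y else 0ℚ
  above x y = if does (y <? x) then h x y else 0ℚ

ℕtoℚ*invℕ : ∀ {n m} (Γ : SignedHypergraph n m) {k} → 0 < k → ℕtoℚ k * invℕ Γ k ≡ 1ℚ
-- Both fractions are already in lowest terms, and then invℕ (suc k) is literally 1/ (ℕtoℚ (suc k)).
ℕtoℚ*invℕ Γ {suc k} _ = begin
  ℕtoℚ (suc k) * invℕ Γ (suc k)
    ≡⟨ cong₂ _*_ (normalize-coprime {suc k} {0} (Coprime.sym (Coprime.1-coprimeTo _)))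
                 (normalize-coprime {1} {k} (Coprime.1-coprimeTo _)) ⟩
  k+1 * 1/k+1
    ≡⟨ *-inverseʳ k+1 ⟩
  1ℚ ∎
  where
  k+1 1/k+1 : ℚ
  k+1   = mkℚ (ℤ.+ suc k) 0 (Coprime.sym (Coprime.1-coprimeTo _))
  1/k+1 = mkℚ (ℤ.+ 1) k (Coprime.1-coprimeTo _)

module _ {n m} (Γ : SignedHypergraph n m) where

  bothIn : Fin n → Fin n → Fin m → Bool
  bothIn x y e = inB x (edge Γ e) ∧ inB y (edge Γ e)

  A-off-diagonal : ∀ {x y} → x ≢ y → A Γ x y ≡ Σℚ (λ e → if bothIn x y e then sgn Γ e else 0ℚ)
  A-off-diagonal {x} {y} x≢y =
    cong (λ b → if b then 0ℚ else Σℚ (λ e → if bothIn x y e then sgn Γ e else 0ℚ)) (dec-false (x ≟ y) x≢y)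

  A-diagonal : ∀ x → A Γ x x ≡ 0ℚ
  A-diagonal x = cong (λ b → if b then 0ℚ else Σℚ (λ e → if bothIn x x e then sgn Γ e else 0ℚ)) (dec-true (x ≟ x) refl)

  -- A is itself defined by the test x ≟ y, so splitting on it with 'with' would also abstract it inside A.
  A-sym : ∀ x y → A Γ x y ≡ A Γ y x
  A-sym x y = by-cases (x ≟ y)
    where
    by-cases : Dec (x ≡ y) → A Γ x y ≡ A Γ y x
    by-cases (yes refl) = refl
    by-cases (no x≢y)   = begin
      A Γ x y                                             ≡⟨ A-off-diagonal x≢y ⟩
      Σℚ (λ e → if bothIn x y e then sgn Γ e else 0ℚ)
        ≡⟨ Σℚ-cong (λ e → cong (λ b → if b then sgn Γ e else 0ℚ) (∧-comm (inB x (edge Γ e)) (inB y (edge Γ e)))) ⟩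
      Σℚ (λ e → if bothIn y x e then sgn Γ e else 0ℚ)   ≡⟨ A-off-diagonal (x≢y ∘ sym) ⟨
      A Γ y x                                             ∎

  A-vanishes-off-commonEdge : ∀ {x y} → commonEdge Γ x y ≡ false → A Γ x y ≡ 0ℚ
  A-vanishes-off-commonEdge {x} {y} disjoint = by-cases (x ≟ y)
    where
    by-cases : Dec (x ≡ y) → A Γ x y ≡ 0ℚ
    by-cases (yes refl) = A-diagonal x
    by-cases (no x≢y)   = trans (A-off-diagonal x≢y) (Σℚ-if-anyB-false (bothIn x y) (sgn Γ) disjoint)

  L-off-diagonal : ∀ {x y} → x ≢ y → L Γ x y ≡ 0ℚ - invℕ Γ (deg Γ x) * A Γ x y
  L-off-diagonal {x} {y} x≢y =
    cong (λ b → (if b then 1ℚ else 0ℚ) - invℕ Γ (deg Γ x) * A Γ x y) (dec-false (x ≟ y) x≢y)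

  deg*-L≡A : ∀ {x y} → 0 < deg Γ x → x ≢ y → ℕtoℚ (deg Γ x) * (- L Γ x y) ≡ A Γ x y
  deg*-L≡A {x} {y} deg-pos x≢y = begin
    d * (- L Γ x y)                ≡⟨ cong (λ l → d * (- l)) (L-off-diagonal x≢y) ⟩
    d * (- (0ℚ - d⁻¹ * A Γ x y))   ≡⟨ solve 3 (λ d i a → d :* (:- (con 0ℚ :- i :* a)) := d :* i :* a) refl d d⁻¹ (A Γ x y) ⟩
    d * d⁻¹ * A Γ x y              ≡⟨ cong (_* A Γ x y) (ℕtoℚ*invℕ Γ deg-pos) ⟩
    1ℚ * A Γ x y                   ≡⟨ *-identityˡ (A Γ x y) ⟩
    A Γ x y                        ∎
    where
    d d⁻¹ : ℚ
    d   = ℕtoℚ (deg Γ x)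
    d⁻¹ = invℕ Γ (deg Γ x)

  deg*L*difference : ∀ (h : Fin n → ℚ) {x} y → 0 < deg Γ x →
                     ℕtoℚ (deg Γ x) * L Γ x y * (h y - h x) ≡ A Γ x y * (h x - h y)
  deg*L*difference h {x} y deg-pos = by-cases (x ≟ y)
    where
    d : ℚ
    d = ℕtoℚ (deg Γ x)
    by-cases : Dec (x ≡ y) → d * L Γ x y * (h y - h x) ≡ A Γ x y * (h x - h y)
    by-cases (yes refl) =
      solve 4 (λ d l a u → d :* l :* (u :- u) := a :* (u :- u)) refl d (L Γ x x) (A Γ x x) (h x)
    by-cases (no x≢y) = begin
      d * L Γ x y * (h y - h x)       ≡⟨ solve 4 (λ d l u v → d :* l :* (v :- u) := d :* (:- l) :* (u :- v)) refl d (L Γ x y) (h x) (h y) ⟩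
      d * (- L Γ x y) * (h x - h y)   ≡⟨ cong (_* (h x - h y)) (deg*-L≡A deg-pos x≢y) ⟩
      A Γ x y * (h x - h y)           ∎

  module _ (f g : Fin n → ℚ) where

    crossTerm : Fin n → Fin n → ℚ
    crossTerm x y = f x * g x * g y * (A Γ x y * (f x - f y))

    crossTerm-diagonal : ∀ x → crossTerm x x ≡ 0ℚ
    crossTerm-diagonal x =
      solve 3 (λ u s a → u :* s :* s :* (a :* (u :- u)) := con 0ℚ) refl (f x) (g x) (A Γ x x)

    crossTerm-symmetrised : ∀ x y →
      crossTerm x y + crossTerm y x ≡ A Γ x y * g x * g y * ((f x - f y) * (f x - f y))
    crossTerm-symmetrised x y = begin
      crossTerm x y + f y * g y * g x * (A Γ y x * (f y - f x))
        ≡⟨ cong (λ a → crossTerm x y + f y * g y * g x * (a * (f y - f x))) (A-sym y x) ⟩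
      crossTerm x y + f y * g y * g x * (A Γ x y * (f y - f x))
        ≡⟨ solve 5 (λ a u v s t → u :* s :* t :* (a :* (u :- v)) :+ v :* t :* s :* (a :* (v :- u))
                               := a :* s :* t :* ((u :- v) :* (u :- v)))
                   refl (A Γ x y) (f x) (f y) (g x) (g y) ⟩
      A Γ x y * g x * g y * ((f x - f y) * (f x - f y)) ∎

    pairTerm : Fin n → Fin n → ℚ
    pairTerm x y = ℕtoℚ (deg Γ x) * (- L Γ x y) * g x * g y * ((f x - f y) * (f x - f y))

    module _ (deg-pos : ∀ i → 0 < deg Γ i) where

      leibniz-term : ∀ x y →
        ℕtoℚ (deg Γ x) * (f x * g x) * (L Γ x y * (f y * g y))
          ≡ ℕtoℚ (deg Γ x) * (f x * g x) * f x * (L Γ x y * g y) + crossTerm x y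
      leibniz-term x y = begin
        d * (f x * g x) * (L Γ x y * (f y * g y))
          ≡⟨ solve 6 (λ d l u v s t → d :* (u :* s) :* (l :* (v :* t))
                                   := d :* (u :* s) :* u :* (l :* t) :+ u :* s :* t :* (d :* l :* (v :- u)))
                     refl d (L Γ x y) (f x) (f y) (g x) (g y) ⟩
        d * (f x * g x) * f x * (L Γ x y * g y) + f x * g x * g y * (d * L Γ x y * (f y - f x))
          ≡⟨ cong (λ t → d * (f x * g x) * f x * (L Γ x y * g y) + f x * g x * g y * t)
                  (deg*L*difference f y (deg-pos x)) ⟩
        d * (f x * g x) * f x * (L Γ x y * g y) + crossTerm x y ∎
        where
        d : ℚ
        d = ℕtoℚ (deg Γ x)

      leibniz-row : ∀ x →
        ℕtoℚ (deg Γ x) * (f x * g x) * Σℚ (λ y → L Γ x y * (f y * g y))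
          ≡ ℕtoℚ (deg Γ x) * (f x * g x) * (f x * Σℚ (λ y → L Γ x y * g y)) + Σℚ (crossTerm x)
      leibniz-row x = begin
        D * Σℚ (λ y → L Γ x y * (f y * g y))
          ≡⟨ *-distribˡ-Σℚ D (λ y → L Γ x y * (f y * g y)) ⟩
        Σℚ (λ y → D * (L Γ x y * (f y * g y)))
          ≡⟨ Σℚ-cong (leibniz-term x) ⟩
        Σℚ (λ y → D * f x * (L Γ x y * g y) + crossTerm x y)
          ≡⟨ Σℚ-distrib-+ (λ y → D * f x * (L Γ x y * g y)) (crossTerm x) ⟩
        Σℚ (λ y → D * f x * (L Γ x y * g y)) + Σℚ (crossTerm x)
          ≡⟨ cong (_+ Σℚ (crossTerm x)) (*-distribˡ-Σℚ (D * f x) (λ y → L Γ x y * g y)) ⟨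
        D * f x * Σℚ (λ y → L Γ x y * g y) + Σℚ (crossTerm x)
          ≡⟨ cong (_+ Σℚ (crossTerm x)) (*-assoc D (f x) (Σℚ (λ y → L Γ x y * g y))) ⟩
        D * (f x * Σℚ (λ y → L Γ x y * g y)) + Σℚ (crossTerm x) ∎
        where
        D : ℚ
        D = ℕtoℚ (deg Γ x) * (f x * g x)

      ⟪fg,L[fg]⟫-expansion : ⟪_,_⟫ Γ (f · g) (applyL Γ (f · g))
                            ≡ ⟪_,_⟫ Γ (f · g) (f · applyL Γ g) + Σℚ (λ x → Σℚ (crossTerm x))
      ⟪fg,L[fg]⟫-expansion =
        trans (Σℚ-cong leibniz-row)
              (Σℚ-distrib-+ (λ x → ℕtoℚ (deg Γ x) * (f x * g x) * (f x * applyL Γ g x))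
                            (λ x → Σℚ (crossTerm x)))

      crossTerm-pair-< : ∀ {x y} → x Fin.< y →
        crossTerm x y + crossTerm y x ≡ (if commonEdge Γ x y then pairTerm x y else 0ℚ)
      crossTerm-pair-< {x} {y} x<y = by-cases (commonEdge Γ x y) refl
        where
        sq : ℚ
        sq = (f x - f y) * (f x - f y)
        by-cases : ∀ b → commonEdge Γ x y ≡ b →
                   crossTerm x y + crossTerm y x ≡ (if b then pairTerm x y else 0ℚ)
        by-cases true _ = begin
          crossTerm x y + crossTerm y x   ≡⟨ crossTerm-symmetrised x y ⟩
          A Γ x y * g x * g y * sq        ≡⟨ cong (λ a → a * g x * g y * sq) (deg*-L≡A (deg-pos x) (<⇒≢ x<y)) ⟨
          pairTerm x y                    ∎
        by-cases false disjoint = begin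
          crossTerm x y + crossTerm y x   ≡⟨ crossTerm-symmetrised x y ⟩
          A Γ x y * g x * g y * sq        ≡⟨ cong (λ a → a * g x * g y * sq) (A-vanishes-off-commonEdge {x} {y} disjoint) ⟩
          0ℚ * g x * g y * sq             ≡⟨ solve 3 (λ s t w → con 0ℚ :* s :* t :* w := con 0ℚ) refl (g x) (g y) sq ⟩
          0ℚ                              ∎

      crossTerm-pair : ∀ x y →
        (if does (x <? y) then crossTerm x y + crossTerm y x else 0ℚ)
          ≡ (if does (x <? y) ∧ commonEdge Γ x y then pairTerm x y else 0ℚ)
      crossTerm-pair x y = by-cases (x <? y)
        where
        by-cases : Dec (x Fin.< y) →
          (if does (x <? y) then crossTerm x y + crossTerm y x else 0ℚ)
            ≡ (if does (x <? y) ∧ commonEdge Γ x y then pairTerm x y else 0ℚ)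
        by-cases (yes x<y) rewrite dec-true (x <? y) x<y = crossTerm-pair-< x<y
        by-cases (no x≮y) rewrite dec-false (x <? y) x≮y = refl

      Σ²crossTerm≡ΣPairs : Σℚ (λ x → Σℚ (crossTerm x)) ≡ ΣPairs Γ pairTerm
      Σ²crossTerm≡ΣPairs =
        trans (Σℚ²-symmetrise crossTerm crossTerm-diagonal)
              (Σℚ-cong (λ x → Σℚ-cong (crossTerm-pair x)))

lemma4p2 : ∀ {n m} (Γ : SignedHypergraph n m)
    → (∀ e e′ → edge Γ e ≡ edge Γ e′ → e ≡ e′)
    → (∀ i → 0 < deg Γ i)
    → (f g : Fin n → ℚ)
    → ⟪_,_⟫ Γ (f · g) (applyL Γ (f · g))
      ≡ ⟪_,_⟫ Γ (f · g) (f · applyL Γ g)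
        + ΣPairs Γ (λ x y → ℕtoℚ (deg Γ x) * (- L Γ x y) * g x * g y
                             * ((f x - f y) * (f x - f y)))
lemma4p2 Γ _ deg-pos f g = begin
  ⟪_,_⟫ Γ (f · g) (applyL Γ (f · g))
    ≡⟨ ⟪fg,L[fg]⟫-expansion Γ f g deg-pos ⟩
  ⟪_,_⟫ Γ (f · g) (f · applyL Γ g) + Σℚ (λ x → Σℚ (crossTerm Γ f g x))
    ≡⟨ cong (⟪_,_⟫ Γ (f · g) (f · applyL Γ g) +_) (Σ²crossTerm≡ΣPairs Γ f g deg-pos) ⟩
  ⟪_,_⟫ Γ (f · g) (f · applyL Γ g) + ΣPairs Γ (pairTerm Γ f g) ∎
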